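{- Let $\varphi,\psi\in\mathrm{Fm}_{\mathsf S}$ and $a,b\in Ag$ with $a\neq b$. Then $\vdash_{\mathsf S}K_a(K_b\varphi\land K_b(\varphi\to\psi))\to K_a(\neg S_{a,b}\psi)$.
   Context: Let $Ag$ be a non-empty finite set of agents and $Var$ a countably infinite set of propositional variables. The formulas $\mathrm{Fm}_{\mathsf S}$ are generated by $\varphi::=p\mid\neg\varphi\mid\varphi\land\varphi\mid I_a\varphi\mid K_a\varphi\mid B_a\varphi$ ($p\in Var$, $a\in Ag$), with $\lor,\to$ classical abbreviations. The logic $\mathsf S$ ($\vdash_{\mathsf S}\varphi$ means $\varphi$ is derivable) has as axioms: all classical tautologies; for each $a$ and $\star\in\{K_a,B_a,I_a\}$, $\star(\varphi\to\psi)\to(\star\varphi\to\star\psi)$; $K_a\varphi\to\varphi$; $K_a\varphi\to K_aK_a\varphi$; $B_a\varphi\to\neg B_a\neg\varphi$; $K_a\varphi\to B_a\varphi$; $B_a\varphi\to K_aB_a\varphi$; $I_a\varphi\to\neg I_a\neg\varphi$; $I_a\varphi\to K_aI_a\varphi$; $I_a\varphi\to I_aK_a\varphi$; $I_a\varphi\to I_aI_a\varphi$; rules: modus ponens and necessitation for each $K_a,B_a,I_a$. $S_{a,b}\varphi:=K_a\varphi\land B_a\neg K_b\varphi\land I_a(\varphi\land\neg K_b\varphi)$. -}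

module Defs where

open import Data.Nat using (ℕ; suc)
open import Data.Fin using (Fin)
open import Data.Bool using (Bool; true; false; not; _∧_)
open import Relation.Binary.PropositionalEquality using (_≡_)

Var : Set
Var = ℕ

module Formulas (n : ℕ) where

  Ag : Set
  Ag = Fin (suc n)

  data Fm : Set where
    var : Var → Fm
    ¬′_ : Fm → Fm
    _∧′_ : Fm → Fm → Fm
    I K B : Ag → Fm → Fm

  infixr 6 _∧′_
  infixr 4 _∨′_ _⇒_

  _∨′_ : Fm → Fm → Fm
  φ ∨′ ψ = ¬′ ((¬′ φ) ∧′ (¬′ ψ))

  _⇒_ : Fm → Fm → Fm
  φ ⇒ ψ = ¬′ (φ ∧′ (¬′ ψ))

  -- Classical tautologies: true under every Boolean valuation that
  -- treats variables and modal formulas as atoms.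
  record Valuation : Set where
    field
      vVar : Var → Bool
      vI vK vB : Ag → Fm → Bool

  eval : Valuation → Fm → Bool
  eval v (var p) = Valuation.vVar v p
  eval v (¬′ φ) = not (eval v φ)
  eval v (φ ∧′ ψ) = eval v φ ∧ eval v ψ
  eval v (I a φ) = Valuation.vI v a φ
  eval v (K a φ) = Valuation.vK v a φ
  eval v (B a φ) = Valuation.vB v a φ

  Tautology : Fm → Set
  Tautology φ = (v : Valuation) → eval v φ ≡ true

  data ⊢_ : Fm → Set where
    taut : ∀ {φ} → Tautology φ → ⊢ φ
    K-distI : ∀ a φ ψ → ⊢ (I a (φ ⇒ ψ) ⇒ (I a φ ⇒ I a ψ))
    K-distK : ∀ a φ ψ → ⊢ (K a (φ ⇒ ψ) ⇒ (K a φ ⇒ K a ψ))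
    K-distB : ∀ a φ ψ → ⊢ (B a (φ ⇒ ψ) ⇒ (B a φ ⇒ B a ψ))
    ax-T    : ∀ a φ → ⊢ (K a φ ⇒ φ)
    ax-4    : ∀ a φ → ⊢ (K a φ ⇒ K a (K a φ))
    ax-DB   : ∀ a φ → ⊢ (B a φ ⇒ ¬′ B a (¬′ φ))
    ax-KB   : ∀ a φ → ⊢ (K a φ ⇒ B a φ)
    ax-BKB  : ∀ a φ → ⊢ (B a φ ⇒ K a (B a φ))
    ax-DI   : ∀ a φ → ⊢ (I a φ ⇒ ¬′ I a (¬′ φ))
    ax-IKI  : ∀ a φ → ⊢ (I a φ ⇒ K a (I a φ))
    ax-IIK  : ∀ a φ → ⊢ (I a φ ⇒ I a (K a φ))
    ax-III  : ∀ a φ → ⊢ (I a φ ⇒ I a (I a φ))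
    mp      : ∀ {φ ψ} → ⊢ (φ ⇒ ψ) → ⊢ φ → ⊢ ψ
    necI    : ∀ a {φ} → ⊢ φ → ⊢ I a φ
    necK    : ∀ a {φ} → ⊢ φ → ⊢ K a φ
    necB    : ∀ a {φ} → ⊢ φ → ⊢ B a φ

  S : Ag → Ag → Fm → Fm
  S a b φ = K a φ ∧′ (B a (¬′ K b φ) ∧′ I a (φ ∧′ ¬′ K b φ))

{-# OPTIONS --safe #-}
module Submission where

open import Defs
open import Data.Nat using (ℕ)
open import Data.Bool using (true; false)
open import Data.Empty using (⊥-elim)
open import Relation.Nullary using (¬_)
open import Relation.Binary.PropositionalEquality using (_≡_; _≢_; refl)

-- From K_b φ and K_b (φ → ψ), closure of knowledge under implication gives K_b ψ,
-- so a knows that b knows ψ. Knowledge implies belief, and by consistency of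
-- belief a then does not believe ¬K_b ψ, which refutes the second conjunct of
-- S_{a,b} ψ. Positive introspection lets a know this conclusion.
module Derivations (n : ℕ) where
  open Formulas n

  private
    variable
      v : Valuation
      φ ψ χ : Fm
      a b : Ag

  -- A record rather than eval v φ ≡ true, so that φ can be inferred from the type.
  record _⊨_ (v : Valuation) (φ : Fm) : Set where
    constructor holds
    field eval≡true : eval v φ ≡ true

  open _⊨_

  taut-⊨ : (∀ v → v ⊨ φ) → ⊢ φ
  taut-⊨ valid = taut λ v → valid v .eval≡true

  ⊨-⇒-intro : (v ⊨ φ → v ⊨ ψ) → v ⊨ (φ ⇒ ψ)
  ⊨-⇒-intro {v} {φ} h .eval≡true with eval v φ in eq
  ... | false = refl
  ... | true rewrite h (holds eq) .eval≡true = refl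

  ⊨-⇒-elim : v ⊨ (φ ⇒ ψ) → v ⊨ φ → v ⊨ ψ
  ⊨-⇒-elim {v} {φ} {ψ} (holds _) (holds _) .eval≡true with eval v φ | eval v ψ
  ... | true | true = refl

  ⊨-¬-intro : ¬ (v ⊨ φ) → v ⊨ (¬′ φ)
  ⊨-¬-intro {v} {φ} h .eval≡true with eval v φ in eq
  ... | false = refl
  ... | true = ⊥-elim (h (holds eq))

  ⊨-¬-elim : v ⊨ (¬′ φ) → ¬ (v ⊨ φ)
  ⊨-¬-elim {v} {φ} (holds _) (holds _) with eval v φ
  ⊨-¬-elim (holds ()) _ | true
  ⊨-¬-elim _ (holds ()) | false

  ⊨-∧-elimˡ : v ⊨ (φ ∧′ ψ) → v ⊨ φ
  ⊨-∧-elimˡ {v} {φ} (holds _) .eval≡true with eval v φ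
  ... | true = refl

  ⊨-∧-elimʳ : v ⊨ (φ ∧′ ψ) → v ⊨ ψ
  ⊨-∧-elimʳ {v} {φ} {ψ} (holds _) .eval≡true with eval v φ | eval v ψ
  ... | true | true = refl

  ⇒-trans : ⊢ (φ ⇒ ψ) → ⊢ (ψ ⇒ χ) → ⊢ (φ ⇒ χ)
  ⇒-trans φ⇒ψ ψ⇒χ = mp (mp (taut-⊨ syllogism) φ⇒ψ) ψ⇒χ
    where
    syllogism : ∀ v → v ⊨ ((φ ⇒ ψ) ⇒ (ψ ⇒ χ) ⇒ (φ ⇒ χ))
    syllogism _ = ⊨-⇒-intro λ f → ⊨-⇒-intro λ g → ⊨-⇒-intro λ x →
      ⊨-⇒-elim g (⊨-⇒-elim f x)

  ⇒-uncurry : ⊢ (ψ ⇒ φ ⇒ χ) → ⊢ (φ ∧′ ψ ⇒ χ)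
  ⇒-uncurry ψ⇒φ⇒χ = mp (taut-⊨ importation) ψ⇒φ⇒χ
    where
    importation : ∀ v → v ⊨ ((ψ ⇒ φ ⇒ χ) ⇒ (φ ∧′ ψ ⇒ χ))
    importation _ = ⊨-⇒-intro λ f → ⊨-⇒-intro λ xy →
      ⊨-⇒-elim (⊨-⇒-elim f (⊨-∧-elimʳ xy)) (⊨-∧-elimˡ xy)

  ⇒-contrapose : ⊢ (φ ⇒ ψ) → ⊢ (¬′ ψ ⇒ ¬′ φ)
  ⇒-contrapose φ⇒ψ = mp (taut-⊨ contraposition) φ⇒ψ
    where
    contraposition : ∀ v → v ⊨ ((φ ⇒ ψ) ⇒ (¬′ ψ ⇒ ¬′ φ))
    contraposition _ = ⊨-⇒-intro λ f → ⊨-⇒-intro λ ¬y → ⊨-¬-intro λ x →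
      ⊨-¬-elim ¬y (⊨-⇒-elim f x)

  ∧-projˡ : ⊢ (φ ∧′ ψ ⇒ φ)
  ∧-projˡ = taut-⊨ λ _ → ⊨-⇒-intro ⊨-∧-elimˡ

  ∧-projʳ : ⊢ (φ ∧′ ψ ⇒ ψ)
  ∧-projʳ = taut-⊨ λ _ → ⊨-⇒-intro ⊨-∧-elimʳ

  K-mono : ⊢ (φ ⇒ ψ) → ⊢ (K a φ ⇒ K a ψ)
  K-mono {φ} {ψ} {a} φ⇒ψ = mp (K-distK a φ ψ) (necK a φ⇒ψ)

  K-closure : ⊢ (K a φ ∧′ K a (φ ⇒ ψ) ⇒ K a ψ)
  K-closure {a} {φ} {ψ} = ⇒-uncurry (K-distK a φ ψ)

  S⇒B¬K : ⊢ (S a b ψ ⇒ B a (¬′ K b ψ))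
  S⇒B¬K = ⇒-trans ∧-projʳ ∧-projˡ

  K⇒¬B¬ : ⊢ (K a φ ⇒ ¬′ B a (¬′ φ))
  K⇒¬B¬ {a} {φ} = ⇒-trans (ax-KB a φ) (ax-DB a φ)

  KK⇒¬S : ⊢ (K a (K b ψ) ⇒ ¬′ S a b ψ)
  KK⇒¬S = ⇒-trans K⇒¬B¬ (⇒-contrapose S⇒B¬K)

proposition13 : (n : ℕ) → let open Formulas n in
    (φ ψ : Fm) (a b : Ag) → a ≢ b →
    ⊢ (K a (K b φ ∧′ K b (φ ⇒ ψ)) ⇒ K a (¬′ S a b ψ))
proposition13 n φ ψ a b _ =
  ⇒-trans (ax-4 a _) (K-mono (⇒-trans (K-mono K-closure) KK⇒¬S))
  where open Formulas n; open Derivations n
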